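{- Let $(S,=,\#,\cdot)$ be a semigroup with apartness, $\mu$ a congruence and $\kappa$ a co-congruence on $S$. (i) $\kappa$ defines an apartness on the factor set $S/\mu$ if and only if $\mu\cap\kappa=\emptyset$. (ii) If $\mu\cap\kappa=\emptyset$ and $S/\mu$ is equipped with the apartness defined by $\kappa$ and the multiplication $x\mu\cdot y\mu=(xy)\mu$, then the quotient map $\pi:S\to S/\mu$, $\pi(x)=x\mu$, is an se-epimorphism.
   Context: Constructive (Bishop-style) setting. A set with apartness: inhabited set with equality $=$ (an equivalence) and $\#$ with $\neg(x\#x)$, $x\#y\Rightarrow y\#x$, $x\#z\Rightarrow\forall y(x\#y\vee y\#z)$; an apartness is extensional w.r.t. equality. A semigroup with apartness is a set with apartness with an associative operation satisfying $ax\#by\Rightarrow(a\#b\vee x\#y)$. A congruence is an equivalence $\mu$ (w.r.t. $=$) with $(x,y),(s,t)\in\mu\Rightarrow(xs,yt)\in\mu$; $S/\mu$ has equality $x\mu=y\mu\iff(x,y)\in\mu$. A co-congruence is a symmetric relation $\kappa$ that is strongly irreflexive ($(x,y)\in\kappa\Rightarrow x\#y$), co-transitive ($(x,y)\in\kappa\Rightarrow\forall z((x,z)\in\kappa\vee(z,y)\in\kappa)$) and co-compatible ($(xz,yt)\in\kappa\Rightarrow(x,y)\in\kappa\vee(z,t)\in\kappa$). $\kappa$ defines an apartness on $S/\mu$ if $x\mu\#y\mu:\iff(x,y)\in\kappa$ gives an apartness on $(S/\mu,=)$. An se-epimorphism is a surjective homomorphism $f$ with $f(x)\#f(y)\Rightarrow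 x\#y$. -}

module Defs where

open import Level using (Level; _⊔_)
open import Data.Product using (Σ; _×_; _,_)
open import Data.Sum using (_⊎_)
open import Data.Empty using (⊥)
open import Relation.Nullary using (¬_)
open import Relation.Binary.Core using (Rel)
open import Relation.Binary.Structures using (IsEquivalence)

record RawSgA (a ℓ₁ ℓ₂ : Level) : Set (Level.suc (a ⊔ ℓ₁ ⊔ ℓ₂)) where
  field
    Carrier : Set a
    _≈_     : Rel Carrier ℓ₁
    _#_     : Rel Carrier ℓ₂
    _∙_     : Carrier → Carrier → Carrier
  infix 4 _≈_ _#_
  infixl 7 _∙_

record IsSetWithApartness {a ℓ₁ ℓ₂} {A : Set a}
    (_≈_ : Rel A ℓ₁) (_#_ : Rel A ℓ₂) : Set (a ⊔ ℓ₁ ⊔ ℓ₂) where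
  field
    inhabitant   : A
    isEquivalence : IsEquivalence _≈_
    irreflexive  : ∀ x → ¬ (x # x)
    symmetric    : ∀ {x y} → x # y → y # x
    cotransitive : ∀ {x z} → x # z → ∀ y → (x # y) ⊎ (y # z)
    extensional  : ∀ {x y x′ y′} → x # y → x ≈ x′ → y ≈ y′ → x′ # y′

record IsSemigroupWithApartness {a ℓ₁ ℓ₂} (S : RawSgA a ℓ₁ ℓ₂) : Set (a ⊔ ℓ₁ ⊔ ℓ₂) where
  open RawSgA S
  field
    isSetWithApartness : IsSetWithApartness _≈_ _#_
    ∙-cong      : ∀ {x y s t} → x ≈ y → s ≈ t → (x ∙ s) ≈ (y ∙ t)
    assoc       : ∀ x y z → ((x ∙ y) ∙ z) ≈ (x ∙ (y ∙ z))
    strongly-extensional : ∀ {a b x y} → (a ∙ x) # (b ∙ y) → (a # b) ⊎ (x # y)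

module _ {a ℓ₁ ℓ₂} (S : RawSgA a ℓ₁ ℓ₂) where
  open RawSgA S

  -- A relation on S is a subset of S × S, hence extensional w.r.t. =.
  RespectsEq : ∀ {r} → Rel Carrier r → Set (a ⊔ ℓ₁ ⊔ r)
  RespectsEq ρ = ∀ {x y x′ y′} → ρ x y → x ≈ x′ → y ≈ y′ → ρ x′ y′

  record IsCongruence {r} (μ : Rel Carrier r) : Set (a ⊔ ℓ₁ ⊔ r) where
    field
      respects     : RespectsEq μ
      isEquivalence : IsEquivalence μ
      compatible   : ∀ {x y s t} → μ x y → μ s t → μ (x ∙ s) (y ∙ t)

  record IsCoCongruence {r} (κ : Rel Carrier r) : Set (a ⊔ ℓ₁ ⊔ ℓ₂ ⊔ r) where
    field
      respects      : RespectsEq κ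
      symmetric     : ∀ {x y} → κ x y → κ y x
      strongly-irreflexive : ∀ {x y} → κ x y → x # y
      cotransitive  : ∀ {x y} → κ x y → ∀ z → κ x z ⊎ κ z y
      cocompatible  : ∀ {x y z t} → κ (x ∙ z) (y ∙ t) → κ x y ⊎ κ z t

  Disjoint : ∀ {r s} → Rel Carrier r → Rel Carrier s → Set (a ⊔ r ⊔ s)
  Disjoint μ κ = ∀ {x y} → μ x y → κ x y → ⊥

  -- The factor structure S/μ: elements are represented by elements of S,
  -- with equality x μ = y μ iff (x,y) ∈ μ, apartness x μ # y μ iff (x,y) ∈ κ,
  -- and multiplication x μ · y μ = (x y) μ.
  Quotient : ∀ {r s} → Rel Carrier r → Rel Carrier s → RawSgA a r s
  Quotient μ κ = record { Carrier = Carrier ; _≈_ = μ ; _#_ = κ ; _∙_ = _∙_ }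

  DefinesApartness : ∀ {r s} → Rel Carrier r → Rel Carrier s → Set (a ⊔ r ⊔ s)
  DefinesApartness μ κ = IsSetWithApartness μ κ

module _ {a b ℓ₁ ℓ₂ ℓ₃ ℓ₄} (S : RawSgA a ℓ₁ ℓ₂) (T : RawSgA b ℓ₃ ℓ₄) where
  private
    module S = RawSgA S
    module T = RawSgA T

  record IsHomomorphism (f : S.Carrier → T.Carrier) : Set (a ⊔ ℓ₁ ⊔ ℓ₃) where
    field
      cong   : ∀ {x y} → x S.≈ y → f x T.≈ f y
      homo   : ∀ x y → f (x S.∙ y) T.≈ (f x T.∙ f y)

  Surjective : (S.Carrier → T.Carrier) → Set (a ⊔ b ⊔ ℓ₃)
  Surjective f = ∀ y → Σ S.Carrier (λ x → f x T.≈ y)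

  record IsSeEpimorphism (f : S.Carrier → T.Carrier) : Set (a ⊔ b ⊔ ℓ₁ ⊔ ℓ₂ ⊔ ℓ₃ ⊔ ℓ₄) where
    field
      isHomomorphism : IsHomomorphism f
      surjective     : Surjective f
      reflects-#     : ∀ {x y} → f x T.# f y → x S.# y

{-# OPTIONS --safe #-}
-- κ is irreflexive on S/μ exactly when no μ-equal pair is κ-apart, and once
-- μ ∩ κ = ∅ the co-transitivity of κ, applied twice, makes κ respect μ; every
-- other apartness axiom on S/μ is inherited from κ. The quotient map is the
-- identity on representatives, so it is a surjective homomorphism, and it
-- reflects apartness because κ ⊆ #.
module Submission where

open import Defs
open import Data.Product using (_×_; _,_)
open import Data.Sum using (inj₁; inj₂)
open import Data.Empty using (⊥-elim)
open import Function.Bundles using (_⇔_; mk⇔)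
open import Relation.Binary.Core using (Rel)
open import Relation.Binary.Definitions using (Reflexive; Symmetric; Cotransitive)
open import Relation.Binary.Structures using (IsEquivalence)

module _ {a ℓ₁ ℓ₂} (S : RawSgA a ℓ₁ ℓ₂) where
  open RawSgA S

  definesApartness⇒disjoint : ∀ {r s} {μ : Rel Carrier r} {κ : Rel Carrier s} →
    DefinesApartness S μ κ → Disjoint S μ κ
  definesApartness⇒disjoint apart {y = y} μxy κxy =
    irreflexive y (extensional κxy μxy (IsEquivalence.refl isEquivalence))
    where open IsSetWithApartness apart

  cotransitive⇒respects : ∀ {r s} {μ : Rel Carrier r} {κ : Rel Carrier s} →
    Symmetric μ → Cotransitive κ → Disjoint S μ κ →
    ∀ {x y x′ y′} → κ x y → μ x x′ → μ y y′ → κ x′ y′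
  cotransitive⇒respects μ-sym κ-cotrans disjoint {x′ = x′} {y′} κxy μxx′ μyy′
    with κ-cotrans κxy x′
  ... | inj₁ κxx′ = ⊥-elim (disjoint μxx′ κxx′)
  ... | inj₂ κx′y with κ-cotrans κx′y y′
  ...   | inj₁ κx′y′ = κx′y′
  ...   | inj₂ κy′y = ⊥-elim (disjoint (μ-sym μyy′) κy′y)

  disjoint⇒definesApartness : ∀ {r s} {μ : Rel Carrier r} {κ : Rel Carrier s} →
    IsSemigroupWithApartness S → IsCongruence S μ → IsCoCongruence S κ →
    Disjoint S μ κ → DefinesApartness S μ κ
  disjoint⇒definesApartness sg cμ cκ disjoint = record
    { inhabitant    = inhabitant
    ; isEquivalence = M.isEquivalence
    ; irreflexive   = λ x κxx → irreflexive x (K.strongly-irreflexive κxx)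
    ; symmetric     = K.symmetric
    ; cotransitive  = K.cotransitive
    ; extensional   = cotransitive⇒respects
        (IsEquivalence.sym M.isEquivalence) K.cotransitive disjoint
    }
    where
    open IsSetWithApartness (IsSemigroupWithApartness.isSetWithApartness sg)
    module M = IsCongruence cμ
    module K = IsCoCongruence cκ

  quotientMap-isSeEpimorphism : ∀ {r s} {μ : Rel Carrier r} {κ : Rel Carrier s} →
    IsSemigroupWithApartness S → IsCongruence S μ → IsCoCongruence S κ →
    IsSeEpimorphism S (Quotient S μ κ) (λ x → x)
  quotientMap-isSeEpimorphism {μ = μ} sg cμ cκ = record
    { isHomomorphism = record
        { cong = λ x≈y → M.respects μ-refl ≈-refl x≈y
        ; homo = λ _ _ → μ-refl
        }
    ; surjective     = λ y → y , μ-refl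
    ; reflects-#     = IsCoCongruence.strongly-irreflexive cκ
    }
    where
    module M = IsCongruence cμ
    μ-refl : Reflexive μ
    μ-refl = IsEquivalence.refl M.isEquivalence
    ≈-refl : Reflexive _≈_
    ≈-refl = IsEquivalence.refl (IsSetWithApartness.isEquivalence
               (IsSemigroupWithApartness.isSetWithApartness sg))

theorem23 : ∀ {a ℓ₁ ℓ₂ r s} (S : RawSgA a ℓ₁ ℓ₂) → IsSemigroupWithApartness S →
    (μ : Rel (RawSgA.Carrier S) r) (κ : Rel (RawSgA.Carrier S) s) →
    IsCongruence S μ → IsCoCongruence S κ →
    (DefinesApartness S μ κ ⇔ Disjoint S μ κ)
    × (Disjoint S μ κ → IsSeEpimorphism S (Quotient S μ κ) (λ x → x))
theorem23 S sg μ κ cμ cκ =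
  mk⇔ (definesApartness⇒disjoint S) (disjoint⇒definesApartness S sg cμ cκ) ,
  λ _ → quotientMap-isSeEpimorphism S sg cμ cκ
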